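{- Let $G$ be a finite simple graph without isolated vertices and of girth five, containing a $5$-cycle $C$ such that no vertex of $C$ is a stem of $G$ and $C$ has two adjacent vertices each of degree at least three in $G$. Then $G\notin\Omega$.
   Context: The girth of $G$ is the length of a shortest cycle. A leaf is a vertex of degree one; a stem is a vertex having at least one leaf as a neighbor. A star is a graph isomorphic to $K_{1,n}$ for some $n\ge 1$. A star-factor of $G$ is a spanning subgraph each of whose connected components is a star. An edge-weighting of $G$ is a function $w:E(G)\to\mathbb{N}^+$ (positive integers), and the weight of a subgraph $H$ is $w(H)=\sum_{e\in E(H)}w(e)$. $\Omega$ denotes the family of all graphs $G$ for which there exists an edge-weighting $w$ of $G$ such that all star-factors of $G$ have the same weight under $w$. -}

module Defs where

open import Data.Nat using (ℕ; zero; suc; _+_; _<_; _≤_)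
open import Data.Fin using (Fin; toℕ; _<?_)
open import Data.Bool using (Bool; true; false; if_then_else_; _∧_)
open import Data.Product using (Σ; _×_; _,_; ∃; ∃-syntax)
open import Data.Sum using (_⊎_)
open import Relation.Binary.PropositionalEquality using (_≡_; _≢_)
open import Relation.Nullary using (¬_)
open import Relation.Nullary.Decidable using (⌊_⌋)
open import Function.Definitions using (Injective)

sumFin : (n : ℕ) → (Fin n → ℕ) → ℕ
sumFin zero    f = 0
sumFin (suc n) f = f Fin.zero + sumFin n (λ i → f (Fin.suc i))


record Graph : Set where
  field
    n      : ℕ
    adj    : Fin n → Fin n → Bool
    sym    : ∀ i j → adj i j ≡ adj j i
    irrefl : ∀ i → adj i i ≡ false

module _ (G : Graph) where
  open Graph G

  Adj : Fin n → Fin n → Set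
  Adj i j = adj i j ≡ true

  degree : Fin n → ℕ
  degree i = sumFin n (λ j → if adj i j then 1 else 0)

  NoIsolatedVertices : Set
  NoIsolatedVertices = ∀ v → ∃[ u ] Adj v u

  IsLeaf : Fin n → Set
  IsLeaf v = degree v ≡ 1

  IsStem : Fin n → Set
  IsStem v = ∃[ u ] (Adj v u × IsLeaf u)

  CycSucc : (k : ℕ) → Fin k → Fin k → Set
  CycSucc k i j = (suc (toℕ i) ≡ toℕ j) ⊎ ((suc (toℕ i) ≡ k) × (toℕ j ≡ 0))

  record Cycle (k : ℕ) : Set where
    field
      len≥3  : 3 ≤ k
      vtx    : Fin k → Fin n
      inj    : Injective _≡_ _≡_ vtx
      closed : ∀ i j → CycSucc k i j → Adj (vtx i) (vtx j)

  GirthEq : ℕ → Set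
  GirthEq g = Cycle g × (∀ k → k < g → ¬ Cycle k)

  record SpanningSubgraph : Set where
    field
      F     : Fin n → Fin n → Bool
      F-sym : ∀ i j → F i j ≡ F j i
      F⊆E   : ∀ i j → F i j ≡ true → Adj i j

  module _ (H : SpanningSubgraph) where
    open SpanningSubgraph H

    data Reach : Fin n → Fin n → Set where
      here : ∀ {x} → Reach x x
      step : ∀ {x y z} → Reach x y → F y z ≡ true → Reach x z

    -- The connected component of v (vertex set {u | Reach v u}) is a star
    -- K_{1,m} with m ≥ 1: it has a centre c adjacent (in H) to every other
    -- vertex of the component, every edge of H inside the component has c as
    -- an endpoint, and the component has a vertex other than c.
    ComponentIsStar : Fin n → Set
    ComponentIsStar v =
      ∃[ c ] (Reach v c
             × (∀ u → Reach v u → u ≢ c → F c u ≡ true)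
             × (∀ x y → Reach v x → F x y ≡ true → (x ≡ c ⊎ y ≡ c))
             × ∃[ u ] (Reach v u × u ≢ c))

    IsStarFactor : Set
    IsStarFactor = ∀ v → ComponentIsStar v

    weight : (Fin n → Fin n → ℕ) → ℕ
    weight w = sumFin n (λ i → sumFin n (λ j →
      if F i j ∧ ⌊ i <? j ⌋ then w i j else 0))

  -- edge-weighting with positive integer values (values off E(G) are irrelevant)
  IsEdgeWeighting : (Fin n → Fin n → ℕ) → Set
  IsEdgeWeighting w = (∀ i j → w i j ≡ w j i) × (∀ i j → Adj i j → 0 < w i j)

  InΩ : Set
  InΩ = ∃[ w ] (IsEdgeWeighting w ×
          (∀ (H₁ H₂ : SpanningSubgraph) → IsStarFactor H₁ → IsStarFactor H₂ →
             weight H₁ w ≡ weight H₂ w))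

module Submission where

-- Let c₀c₁ be the edge of C whose ends have degree at least three. Girth five makes C chordless,
-- so c₀ and c₁ have neighbours x and y off C, and every vertex off C has a neighbour off C (a
-- vertex whose only neighbours lie on C has just one of them and would make it a stem). Hence
-- G − V(C) has a star factor S. If x is a leaf of a star of S with further leaves, cut it off:
-- the rest of S extends to star factors of G in four ways on x, c₀, …, c₄, and equating their
-- weights forces an edge of C to have weight 0. The same applies to y. Otherwise x and y are
-- centres of S, and four extensions attaching c₀ to x and/or c₁ to y again force a zero weight.

open import Defs
open import Data.Bool using (Bool; true; false; if_then_else_; _∧_; _∨_; not)
import Data.Bool as Bool
open import Data.Bool.Properties using (not-¬; ∧-comm; ∨-comm; ∨-zeroʳ; ∨-identityʳ; ∧-zeroʳ)
open import Data.Empty using (⊥; ⊥-elim)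
open import Data.Fin using (Fin; toℕ; fromℕ; _≟_; _<?_)
open import Data.Fin.Patterns using (0F; 1F; 2F; 3F; 4F; 5F; 6F)
open import Data.Fin.Properties using (all?; any?; toℕ-injective; toℕ-fromℕ; <-asym; <-cmp)
open import Data.List using (List; []; _∷_; allFin; map)
open import Data.List.Membership.Propositional using (_∈_)
open import Data.List.Membership.Propositional.Properties using (∈-allFin)
import Data.List.Membership.DecPropositional as DecMembership
open import Data.List.Relation.Unary.All using (All; []; _∷_)
import Data.List.Relation.Unary.All as All
open import Data.List.Relation.Unary.Any using (here; there)
open import Data.Nat using (ℕ; zero; suc; _+_; _<_; _≤_; z≤n; s≤s)
open import Data.Nat.ListAction using (sum)
open import Data.Nat.Properties using (+-identityʳ; +-assoc; +-mono-≤; +-cancelˡ-≡; +-cancelʳ-≡)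
import Data.Nat.Properties as ℕ
open import Algebra.Properties.CommutativeSemigroup ℕ.+-commutativeSemigroup
  using () renaming (interchange to +-interchange)
open import Data.Product using (Σ; _×_; _,_; ∃-syntax; proj₁; proj₂)
open import Data.Product.Properties using (≡-dec)
open import Data.Sum using (_⊎_; inj₁; inj₂; [_,_]′)
import Data.Sum as Sum
open import Data.Vec using (Vec; []; _∷_; lookup)
import Data.Vec.Functional as Vector
open import Data.Vec.Relation.Unary.All using ([]; _∷_)
open import Data.Vec.Relation.Unary.AllPairs using ([]; _∷_)
open import Data.Vec.Relation.Unary.Linked using (Linked; [-]; _∷_)
open import Data.Vec.Relation.Unary.Unique.Propositional using (Unique)
open import Data.Vec.Relation.Unary.Unique.Propositional.Properties using (lookup-injective)
open import Relation.Binary.Definitions using (tri<; tri≈; tri>)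
open import Relation.Binary.PropositionalEquality
open import Relation.Nullary using (¬_; Dec; yes; no; does)
open import Relation.Nullary.Decidable
  using (⌊_⌋; toSum; dec-true; dec-false; toWitness; _×-dec_; _⊎-dec_; _→-dec_; ¬?)

sumFin-cong : ∀ n {f g : Fin n → ℕ} → (∀ i → f i ≡ g i) → sumFin n f ≡ sumFin n g
sumFin-cong zero    f≗g = refl
sumFin-cong (suc n) f≗g = cong₂ _+_ (f≗g Fin.zero) (sumFin-cong n (λ i → f≗g (Fin.suc i)))

sumFin-mono : ∀ n {f g : Fin n → ℕ} → (∀ i → f i ≤ g i) → sumFin n f ≤ sumFin n g
sumFin-mono zero    f≤g = z≤n
sumFin-mono (suc n) f≤g = +-mono-≤ (f≤g Fin.zero) (sumFin-mono n (λ i → f≤g (Fin.suc i)))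

sumFin-+ : ∀ n (f g : Fin n → ℕ) → sumFin n (λ i → f i + g i) ≡ sumFin n f + sumFin n g
sumFin-+ zero    f g = refl
sumFin-+ (suc n) f g =
  trans (cong (f Fin.zero + g Fin.zero +_) (sumFin-+ n _ _)) (+-interchange (f Fin.zero) (g Fin.zero) _ _)

sumFin-zero : ∀ n → sumFin n (λ _ → 0) ≡ 0
sumFin-zero zero    = refl
sumFin-zero (suc n) = sumFin-zero n

sumFin-indicator : ∀ n (b : Fin n) (m : ℕ) → sumFin n (λ j → if does (j ≟ b) then m else 0) ≡ m
sumFin-indicator (suc n) Fin.zero m = begin
  m + sumFin n (λ _ → 0)  ≡⟨ cong (m +_) (sumFin-zero n) ⟩
  m + 0                   ≡⟨ +-identityʳ m ⟩
  m                       ∎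
  where open ≡-Reasoning
sumFin-indicator (suc n) (Fin.suc b) m = sumFin-indicator n b m

does⇒witness : ∀ {A : Set} (d : Dec A) → does d ≡ true → A
does⇒witness (yes a) _ = a

∧-true : ∀ x {y} → x ∧ y ≡ true → x ≡ true × y ≡ true
∧-true true e = refl , e

∨-true : ∀ {x y} → x ∨ y ≡ true → x ≡ true ⊎ y ≡ true
∨-true {true}  _ = inj₁ refl
∨-true {false} e = inj₂ e

linked-consecutive : ∀ {A : Set} {R : A → A → Set} {m} {xs : Vec A m} → Linked R xs →
                     ∀ i j → suc (toℕ i) ≡ toℕ j → R (lookup xs i) (lookup xs j)
linked-consecutive {xs = _ ∷ _ ∷ _} (r ∷ _) 0F 1F _ = r
linked-consecutive (_ ∷ rs) (Fin.suc i) (Fin.suc j) e = linked-consecutive rs i j (ℕ.suc-injective e)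

cons-injective : ∀ {A : Set} {k} {a : A} {f : Fin k → A} →
                 (∀ {i j} → f i ≡ f j → i ≡ j) → (∀ i → f i ≢ a) →
                 ∀ {i j} → (a Vector.∷ f) i ≡ (a Vector.∷ f) j → i ≡ j
cons-injective f-inj a∉f {0F}        {0F}        _ = refl
cons-injective f-inj a∉f {0F}        {Fin.suc j} e = ⊥-elim (a∉f j (sym e))
cons-injective f-inj a∉f {Fin.suc i} {0F}        e = ⊥-elim (a∉f i e)
cons-injective f-inj a∉f {Fin.suc i} {Fin.suc j} e = cong Fin.suc (f-inj e)

next : Fin 5 → Fin 5
next 0F = 1F
next 1F = 2F
next 2F = 3F
next 3F = 4F
next 4F = 0F

next-injective : ∀ {i j} → next i ≡ next j → i ≡ j
next-injective {i} {j} = toWitness {a? = all? λ i → all? λ j → (next i ≟ next j) →-dec (i ≟ j)} _ i j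

next-surjective : ∀ j → ∃[ i ] next i ≡ j
next-surjective = toWitness {a? = all? λ j → any? λ i → next i ≟ j} _

within-two-steps : ∀ i j → i ≢ j → (j ≡ next i ⊎ i ≡ next j) ⊎ (j ≡ next (next i) ⊎ i ≡ next (next j))
within-two-steps = toWitness {a? = all? λ i → all? λ j →
  ¬? (i ≟ j) →-dec ((j ≟ next i ⊎-dec i ≟ next j) ⊎-dec (j ≟ next (next i) ⊎-dec i ≟ next (next j)))} _

next^ : ℕ → Fin 5 → Fin 5
next^ zero    i = i
next^ (suc m) i = next (next^ m i)

next^-next : ∀ m i → next^ m (next i) ≡ next (next^ m i)
next^-next zero    i = refl
next^-next (suc m) i = cong next (next^-next m i)

next^-injective : ∀ m {i j} → next^ m i ≡ next^ m j → i ≡ j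
next^-injective zero    e = e
next^-injective (suc m) e = next^-injective m (next-injective e)

next^-from-0 : ∀ i → next^ (toℕ i) 0F ≡ i
next^-from-0 = toWitness {a? = all? λ i → next^ (toℕ i) 0F ≟ i} _

pendant-arithmetic : ∀ a b d e f g h → a + (b + (h + 0)) ≡ a + (d + (e + (h + 0))) →
                     a + (f + (b + (g + 0))) ≡ a + (f + (d + (g + 0))) → e ≡ 0
pendant-arithmetic a b d e f g h eq₁ eq₂ = +-cancelˡ-≡ d e 0 (begin
  d + e  ≡⟨ sym b≡d+e ⟩
  b      ≡⟨ b≡d ⟩
  d      ≡⟨ sym (+-identityʳ d) ⟩
  d + 0  ∎)
  where
  open ≡-Reasoning
  b≡d : b ≡ d
  b≡d = +-cancelʳ-≡ (g + 0) b d (+-cancelˡ-≡ f _ _ (+-cancelˡ-≡ a _ _ eq₂))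
  b≡d+e : b ≡ d + e
  b≡d+e = +-cancelʳ-≡ (h + 0) b (d + e) (trans (+-cancelˡ-≡ a _ _ eq₁) (sym (+-assoc d e (h + 0))))

centre-arithmetic : ∀ a b c c′ e g y → a + (b + (c + 0)) ≡ a + (y + (e + (c′ + 0))) →
                    y + (e + (g + 0)) ≡ b + (c + (g + 0)) → c′ ≡ 0
centre-arithmetic a b c c′ e g y eq₁ eq₂ = sym (+-cancelˡ-≡ (y + e) 0 c′ (begin
  y + e + 0    ≡⟨ +-identityʳ (y + e) ⟩
  y + e        ≡⟨ y+e≡b+c ⟩
  b + c        ≡⟨ b+c≡y+e+c′ ⟩
  y + e + c′   ∎))
  where
  open ≡-Reasoning
  y+e≡b+c : y + e ≡ b + c
  y+e≡b+c = +-cancelʳ-≡ (g + 0) _ _ (trans (+-assoc y e (g + 0)) (trans eq₂ (sym (+-assoc b c (g + 0)))))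
  b+c≡y+e+c′ : b + c ≡ y + e + c′
  b+c≡y+e+c′ = begin
    b + c              ≡⟨ cong (b +_) (sym (+-identityʳ c)) ⟩
    b + (c + 0)        ≡⟨ +-cancelˡ-≡ a _ _ eq₁ ⟩
    y + (e + (c′ + 0)) ≡⟨ cong (λ t → y + (e + t)) (+-identityʳ c′) ⟩
    y + (e + c′)       ≡⟨ sym (+-assoc y e c′) ⟩
    y + e + c′         ∎

module _ (G : Graph) where
  open Graph G using (n; adj; irrefl) renaming (sym to adj-sym)

  Adj-sym : ∀ {a b} → Adj G a b → Adj G b a
  Adj-sym {a} {b} p = trans (adj-sym b a) p

  Adj-irrefl : ∀ {a b} → Adj G a b → a ≢ b
  Adj-irrefl {a} p refl = not-¬ p (irrefl a)

  degree-pendant : ∀ {a b} → Adj G a b → (∀ s → Adj G a s → s ≡ b) → degree G a ≡ 1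
  degree-pendant {a} {b} ab only-b = trans (sumFin-cong n indicator) (sumFin-indicator n b 1)
    where
    indicator : ∀ s → (if adj a s then 1 else 0) ≡ (if does (s ≟ b) then 1 else 0)
    indicator s with adj a s in as | s ≟ b
    ... | true  | yes _    = refl
    ... | true  | no s≢b   = ⊥-elim (s≢b (only-b s as))
    ... | false | yes refl = ⊥-elim (not-¬ ab as)
    ... | false | no _     = refl

  degree≤2 : ∀ {a b c} → (∀ s → Adj G a s → s ≡ b ⊎ s ≡ c) → degree G a ≤ 2
  degree≤2 {a} {b} {c} only-bc = subst (degree G a ≤_) two (sumFin-mono n bound)
    where
    two : sumFin n (λ s → (if does (s ≟ b) then 1 else 0) + (if does (s ≟ c) then 1 else 0)) ≡ 2
    two = trans (sumFin-+ n _ _) (cong₂ _+_ (sumFin-indicator n b 1) (sumFin-indicator n c 1))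
    bound : ∀ s → (if adj a s then 1 else 0) ≤ (if does (s ≟ b) then 1 else 0) + (if does (s ≟ c) then 1 else 0)
    bound s with adj a s in as | s ≟ b | s ≟ c
    ... | false | _     | _     = z≤n
    ... | true  | yes _ | _     = s≤s z≤n
    ... | true  | no _  | yes _ = s≤s z≤n
    ... | true  | no s≢b | no s≢c = ⊥-elim ([ s≢b , s≢c ]′ (only-bc s as))

  cycleFromVec : ∀ {k} (vs : Vec (Fin n) (suc k)) → 3 ≤ suc k → Unique vs → Linked (Adj G) vs →
                 Adj G (lookup vs (fromℕ k)) (lookup vs 0F) → Cycle G (suc k)
  cycleFromVec {k} vs 3≤1+k distinct path closing = record
    { len≥3 = 3≤1+k ; vtx = lookup vs ; inj = λ {i} {j} → lookup-injective distinct i j ; closed = closed }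
    where
    closed : ∀ i j → CycSucc G (suc k) i j → Adj G (lookup vs i) (lookup vs j)
    closed i j (inj₁ i→j)        = linked-consecutive path i j i→j
    closed i j (inj₂ (i-last , j-first))
      rewrite toℕ-injective {i = i} {j = fromℕ k} (trans (ℕ.suc-injective i-last) (sym (toℕ-fromℕ k)))
            | toℕ-injective {i = j} {j = 0F} j-first = closing

  -- Star forests

  EdgeSet : Set
  EdgeSet = Fin n → Fin n → Bool

  edge : Fin n → Fin n → EdgeSet
  edge a b i j = (does (i ≟ a) ∧ does (j ≟ b)) ∨ (does (i ≟ b) ∧ does (j ≟ a))

  edge-endpoints : ∀ {a b i j} → edge a b i j ≡ true → (i ≡ a × j ≡ b) ⊎ (i ≡ b × j ≡ a)
  edge-endpoints {a} {b} {i} {j} e with i ≟ a | j ≟ b | i ≟ b | j ≟ a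
  ... | yes i≡a | yes j≡b | _      | _      = inj₁ (i≡a , j≡b)
  ... | _       | _       | yes i≡b | yes j≡a = inj₂ (i≡b , j≡a)
  ... | no _    | _       | no _   | _      = ⊥-elim (not-¬ e refl)
  ... | no _    | _       | yes _  | no _   = ⊥-elim (not-¬ e refl)
  ... | yes _   | no _    | no _   | _      = ⊥-elim (not-¬ e refl)
  ... | yes _   | no _    | yes _  | no _   = ⊥-elim (not-¬ e refl)

  edge-forward : ∀ a b → edge a b a b ≡ true
  edge-forward a b rewrite dec-true (a ≟ a) refl | dec-true (b ≟ b) refl = refl

  edge-backward : ∀ a b → edge a b b a ≡ true
  edge-backward a b rewrite dec-true (a ≟ a) refl | dec-true (b ≟ b) refl =
    ∨-zeroʳ (does (b ≟ a) ∧ does (a ≟ b))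

  edge-sym : ∀ a b i j → edge a b i j ≡ edge a b j i
  edge-sym a b i j rewrite ∧-comm (does (i ≟ a)) (does (j ≟ b)) | ∧-comm (does (i ≟ b)) (does (j ≟ a)) =
    ∨-comm (does (j ≟ b) ∧ does (i ≟ a)) _

  edge-away : ∀ {a b i} j → i ≢ a → i ≢ b → edge a b i j ≡ false
  edge-away {a} {b} {i} j i≢a i≢b rewrite dec-false (i ≟ a) i≢a | dec-false (i ≟ b) i≢b = refl

  edge-without-endpoint : ∀ {a b i j} → i ≢ b → j ≢ b → edge a b i j ≡ false
  edge-without-endpoint {a} {b} {i} {j} i≢b j≢b with edge a b i j in e
  ... | false = refl
  ... | true  = ⊥-elim ([ (λ (_ , j≡b) → j≢b j≡b) , (λ (i≡b , _) → i≢b i≡b) ]′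
                           (edge-endpoints {a} {b} {i} {j} e))

  Pendant : EdgeSet → Fin n → Fin n → Set
  Pendant F a b = ∀ t → F a t ≡ true → t ≡ b

  Centre : EdgeSet → Fin n → Set
  Centre F u = ∀ z → F u z ≡ true → Pendant F z u

  Covered : EdgeSet → Fin n → Set
  Covered F z = ∃[ t ] F z t ≡ true

  Isolated : EdgeSet → Fin n → Set
  Isolated F z = ∀ t → F z t ≡ false

  covered? : ∀ F z → Dec (Covered F z)
  covered? F z = any? λ t → F z t Bool.≟ true

  uncovered⇒isolated : ∀ {F z} → ¬ Covered F z → Isolated F z
  uncovered⇒isolated {F} {z} uncovered t with F z t in e
  ... | false = refl
  ... | true  = ⊥-elim (uncovered (t , e))

  isolated⇒centre : ∀ {F u} → Isolated F u → Centre F u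
  isolated⇒centre isolated z e = ⊥-elim (not-¬ e (isolated z))

  -- Every edge has an end whose only neighbour is the other end, so each component is a star or a
  -- single vertex.
  record IsStarForest (F : EdgeSet) : Set where
    field
      symmetric   : ∀ i j → F i j ≡ F j i
      ⊆G          : ∀ i j → F i j ≡ true → Adj G i j
      pendant-end : ∀ a b → F a b ≡ true → Pendant F a b ⊎ Pendant F b a

  open IsStarForest

  ∅-starForest : IsStarForest (λ _ _ → false)
  ∅-starForest = record { symmetric = λ _ _ → refl ; ⊆G = λ _ _ () ; pendant-end = λ _ _ () }

  module _ {F : EdgeSet} (forest : IsStarForest F) where

    flip-edge : ∀ {i j} → F i j ≡ true → F j i ≡ true
    flip-edge {i} {j} e = trans (symmetric forest j i) e

    absent-if-nonadjacent : ∀ {i j} → ¬ Adj G i j → F i j ≡ false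
    absent-if-nonadjacent {i} {j} i≁j with F i j in ij
    ... | false = refl
    ... | true  = ⊥-elim (i≁j (⊆G forest i j ij))

    isolated-apart : ∀ {z} → Isolated F z → ∀ a → F a z ≡ false
    isolated-apart {z} isolated a = trans (symmetric forest a z) (isolated a)

    pendant⇒centre : ∀ {u c} → F u c ≡ true → Pendant F c u → Centre F u
    pendant⇒centre {u} {c} uc c-pendant z uz with pendant-end forest u z uz
    ... | inj₂ z-pendant = z-pendant
    ... | inj₁ u-pendant with u-pendant c uc
    ... | refl = c-pendant

    centre-or-pendant : ∀ {u c} → F u c ≡ true →
                        Centre F u ⊎ (Pendant F u c × ∃[ t ] (F c t ≡ true × t ≢ u))
    centre-or-pendant {u} {c} uc with pendant-end forest u c uc
    ... | inj₂ c-pendant = inj₁ (pendant⇒centre uc c-pendant)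
    ... | inj₁ u-pendant with any? (λ t → (F c t Bool.≟ true) ×-dec ¬? (t ≟ u))
    ... | yes other-leaf = inj₂ (u-pendant , other-leaf)
    ... | no no-other-leaf = inj₁ (pendant⇒centre uc c-pendant)
      where
      c-pendant : Pendant F c u
      c-pendant t ct with t ≟ u
      ... | yes t≡u = t≡u
      ... | no t≢u  = ⊥-elim (no-other-leaf (t , ct , t≢u))

  addEdge : EdgeSet → Fin n → Fin n → EdgeSet
  addEdge F u v i j = F i j ∨ edge u v i j

  removeEdge : EdgeSet → Fin n → Fin n → EdgeSet
  removeEdge F c x i j = F i j ∧ not (edge c x i j)

  addEdge-covered-centre : ∀ {F} u v → Covered (addEdge F u v) u
  addEdge-covered-centre {F} u v = v , trans (cong (F u v ∨_) (edge-forward u v)) (∨-zeroʳ (F u v))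

  addEdge-covered-leaf : ∀ {F} u v → Covered (addEdge F u v) v
  addEdge-covered-leaf {F} u v = u , trans (cong (F v u ∨_) (edge-backward u v)) (∨-zeroʳ (F v u))

  module _ {F : EdgeSet} (forest : IsStarForest F) {u v : Fin n} (uv : Adj G u v) (v-isolated : Isolated F v) where
    private
      F′ : EdgeSet
      F′ = addEdge F u v

    addEdge-unchanged : ∀ {z} t → z ≢ u → z ≢ v → F′ z t ≡ F z t
    addEdge-unchanged {z} t z≢u z≢v = trans (cong (F z t ∨_) (edge-away t z≢u z≢v)) (∨-identityʳ (F z t))

    addEdge-⊇ : ∀ {i j} → F i j ≡ true → F′ i j ≡ true
    addEdge-⊇ {i} {j} e rewrite e = refl

    addEdge-pendant-leaf : Pendant F′ v u
    addEdge-pendant-leaf t e with F v t in vt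
    ... | true = ⊥-elim (not-¬ vt (v-isolated t))
    ... | false with edge-endpoints e
    ... | inj₁ (v≡u , _) = ⊥-elim (Adj-irrefl uv (sym v≡u))
    ... | inj₂ (_ , t≡u) = t≡u

    addEdge-pendant : ∀ {z b} → z ≢ u → z ≢ v → Pendant F z b → Pendant F′ z b
    addEdge-pendant z≢u z≢v pendant t e = pendant t (trans (sym (addEdge-unchanged t z≢u z≢v)) e)

    addEdge-covered : ∀ {z} → Covered F z → Covered F′ z
    addEdge-covered (t , e) = t , addEdge-⊇ e

    addEdge-isolated : ∀ {z} → Isolated F z → z ≢ u → z ≢ v → Isolated F′ z
    addEdge-isolated isolated z≢u z≢v t = trans (addEdge-unchanged t z≢u z≢v) (isolated t)

    private
      ≢-leaf : ∀ {a} b → F a b ≡ true → a ≢ v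
      ≢-leaf {a} b e refl = not-¬ e (v-isolated b)

    addEdge-centre-other : ∀ {z} → Centre F z → z ≢ u → z ≢ v → F z u ≡ false → Centre F′ z
    addEdge-centre-other {z} centre z≢u z≢v zu-absent t e =
      addEdge-pendant t≢u (≢-leaf z (flip-edge forest zt)) (centre t zt)
      where
      zt : F z t ≡ true
      zt = trans (sym (addEdge-unchanged t z≢u z≢v)) e
      t≢u : t ≢ u
      t≢u refl = not-¬ zt zu-absent

    module _ (u-centre : Centre F u) where

      addEdge-centre : Centre F′ u
      addEdge-centre z e with F u z in uz
      ... | true  = addEdge-pendant (λ z≡u → Adj-irrefl (⊆G forest u z uz) (sym z≡u))
                                    (≢-leaf u (flip-edge forest uz)) (u-centre z uz)
      ... | false with edge-endpoints {u} {v} {u} {z} e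
      ... | inj₁ (_ , refl) = λ t → addEdge-pendant-leaf t
      ... | inj₂ (u≡v , _)  = ⊥-elim (Adj-irrefl uv u≡v)

      addEdge-starForest : IsStarForest F′
      addEdge-starForest = record { symmetric = symmetric′ ; ⊆G = ⊆G′ ; pendant-end = pendant-end′ }
        where
        symmetric′ : ∀ i j → F′ i j ≡ F′ j i
        symmetric′ i j = cong₂ _∨_ (symmetric forest i j) (edge-sym u v i j)

        ⊆G′ : ∀ i j → F′ i j ≡ true → Adj G i j
        ⊆G′ i j e with F i j in ij
        ... | true = ⊆G forest i j ij
        ... | false with edge-endpoints {u} {v} {i} {j} e
        ... | inj₁ (refl , refl) = uv
        ... | inj₂ (refl , refl) = Adj-sym uv

        pendant-end′ : ∀ a b → F′ a b ≡ true → Pendant F′ a b ⊎ Pendant F′ b a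
        pendant-end′ a b e with F a b in ab
        ... | false with edge-endpoints {u} {v} {a} {b} e
        ... | inj₁ (refl , refl) = inj₂ (λ t → addEdge-pendant-leaf t)
        ... | inj₂ (refl , refl) = inj₁ (λ t → addEdge-pendant-leaf t)
        pendant-end′ a b e | true = by-cases (a ≟ u) (b ≟ u)
          where
          by-cases : Dec (a ≡ u) → Dec (b ≡ u) → Pendant F′ a b ⊎ Pendant F′ b a
          by-cases (yes refl) _ = inj₂ (addEdge-pendant (λ b≡a → Adj-irrefl (⊆G forest a b ab) (sym b≡a))
                                                        (≢-leaf a (flip-edge forest ab)) (u-centre b ab))
          by-cases (no a≢u) (yes refl) = inj₁ (addEdge-pendant a≢u (≢-leaf b ab) (u-centre a (flip-edge forest ab)))
          by-cases (no a≢u) (no b≢u) = Sum.map (addEdge-pendant a≢u (≢-leaf b ab))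
                                                    (addEdge-pendant b≢u (≢-leaf a (flip-edge forest ab)))
                                                    (pendant-end forest a b ab)

  module _ {F : EdgeSet} (forest : IsStarForest F) {c x : Fin n} where
    private
      F′ : EdgeSet
      F′ = removeEdge F c x

    removeEdge-⊆ : ∀ {i j} → F′ i j ≡ true → F i j ≡ true
    removeEdge-⊆ {i} {j} e with F i j
    ... | true  = refl
    ... | false = e

    removeEdge-starForest : IsStarForest F′
    removeEdge-starForest = record
      { symmetric   = λ i j → cong₂ (λ p q → p ∧ not q) (symmetric forest i j) (edge-sym c x i j)
      ; ⊆G          = λ i j e → ⊆G forest i j (removeEdge-⊆ e)
      ; pendant-end = λ a b e → Sum.map (λ p t e′ → p t (removeEdge-⊆ e′)) (λ p t e′ → p t (removeEdge-⊆ e′))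
                                        (pendant-end forest a b (removeEdge-⊆ e))
      }

    removeEdge-isolated : ∀ {z} → Isolated F z → Isolated F′ z
    removeEdge-isolated {z} isolated t rewrite isolated t = refl

    removeEdge-isolates : Pendant F x c → Isolated F′ x
    removeEdge-isolates pendant t with F x t in xt
    ... | false = refl
    ... | true rewrite pendant t xt | edge-backward c x = refl

    removeEdge-covered-except : ∀ {t} → F c t ≡ true → t ≢ x → ∀ {z} → Covered F z → Covered F′ z ⊎ z ≡ x
    removeEdge-covered-except {t} ct t≢x {z} (s , zs) = by-cases (z ≟ x) (z ≟ c)
      where
      kept : ∀ {i j} → F i j ≡ true → edge c x i j ≡ false → Covered F′ i
      kept {i} {j} ij not-removed = j , cong₂ (λ p q → p ∧ not q) ij not-removed
      t≢c : t ≢ c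
      t≢c t≡c = Adj-irrefl (⊆G forest c t ct) (sym t≡c)
      by-cases : Dec (z ≡ x) → Dec (z ≡ c) → Covered F′ z ⊎ z ≡ x
      by-cases (yes z≡x) _          = inj₂ z≡x
      by-cases (no _)    (yes refl) = inj₁ (kept ct (trans (edge-sym c x c t) (edge-away c t≢c t≢x)))
      by-cases (no z≢x)  (no z≢c)   = inj₁ (kept zs (edge-away s z≢c z≢x))

  toSpanning : ∀ {F} → IsStarForest F → SpanningSubgraph G
  toSpanning {F} forest = record { F = F ; F-sym = symmetric forest ; F⊆E = ⊆G forest }

  module _ {F : EdgeSet} (forest : IsStarForest F) where
    private
      H : SpanningSubgraph G
      H = toSpanning forest

    module _ {c : Fin n} (centre : Centre F c) {v : Fin n} (v-near : v ≡ c ⊎ F c v ≡ true) where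

      reach-near-centre : ∀ {x} → Reach G H v x → x ≡ c ⊎ F c x ≡ true
      reach-near-centre here = v-near
      reach-near-centre (step {y = y} r e) with reach-near-centre r
      ... | inj₁ refl = inj₂ e
      ... | inj₂ cy   = inj₁ (centre y cy _ e)

      reach-centre : Reach G H v c
      reach-centre = [ (λ { refl → here }) , (λ cv → step here (flip-edge forest cv)) ]′ v-near

      component-star : Covered F c → ComponentIsStar G H v
      component-star (t , ct) = c , reach-centre , spoke , via-centre , (t , step reach-centre ct , t≢c)
        where
        spoke : ∀ x → Reach G H v x → x ≢ c → F c x ≡ true
        spoke x r x≢c = [ (λ x≡c → ⊥-elim (x≢c x≡c)) , (λ cx → cx) ]′ (reach-near-centre r)
        via-centre : ∀ x y → Reach G H v x → F x y ≡ true → x ≡ c ⊎ y ≡ c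
        via-centre x y r xy = Sum.map₂ (λ cx → centre x cx y xy) (reach-near-centre r)
        t≢c : t ≢ c
        t≢c t≡c = Adj-irrefl (⊆G forest c t ct) (sym t≡c)

    starForest⇒starFactor : (∀ z → Covered F z) → IsStarFactor G H
    starForest⇒starFactor covered v with covered v
    ... | t , vt with pendant-end forest v t vt
    ... | inj₁ v-pendant = component-star (pendant⇒centre forest tv v-pendant) (inj₂ tv) (v , tv)
      where
      tv : F t v ≡ true
      tv = flip-edge forest vt
    ... | inj₂ t-pendant = component-star (pendant⇒centre forest vt t-pendant) (inj₁ refl) (t , vt)

  module _ (w : Fin n → Fin n → ℕ) where

    -- `weight G (toSpanning forest) w` unfolds to `weightOf w F`.
    weightOf : EdgeSet → ℕ
    weightOf F = sumFin n (λ i → sumFin n (λ j → if F i j ∧ ⌊ i <? j ⌋ then w i j else 0))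

    weightOf-∨ : ∀ F₁ F₂ → (∀ i j → F₁ i j ≡ true → F₂ i j ≡ false) →
                 weightOf (λ i j → F₁ i j ∨ F₂ i j) ≡ weightOf F₁ + weightOf F₂
    weightOf-∨ F₁ F₂ disjoint =
      trans (sumFin-cong n λ i → trans (sumFin-cong n λ j → split (F₁ i j) (F₂ i j) _ _ (disjoint i j))
                                        (sumFin-+ n _ _))
            (sumFin-+ n _ _)
      where
      split : ∀ p q l m → (p ≡ true → q ≡ false) →
              (if (p ∨ q) ∧ l then m else 0) ≡ (if p ∧ l then m else 0) + (if q ∧ l then m else 0)
      split false q     l     m _     = refl
      split true  false false m _     = refl
      split true  true  false m _     = refl
      split true  false true  m _     = sym (+-identityʳ m)
      split true  true  true  m p⇒¬q with () ← p⇒¬q refl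

    private
      forward : Fin n → Fin n → ℕ
      forward a b = if ⌊ a <? b ⌋ then w a b else 0

      weightOf-arc : ∀ a b → weightOf (λ i j → does (i ≟ a) ∧ does (j ≟ b)) ≡ forward a b
      weightOf-arc a b = trans (sumFin-cong n row) (sumFin-indicator n a (forward a b))
        where
        row : ∀ i → sumFin n (λ j → if (does (i ≟ a) ∧ does (j ≟ b)) ∧ ⌊ i <? j ⌋ then w i j else 0)
                    ≡ (if does (i ≟ a) then forward a b else 0)
        row i with i ≟ a
        ... | no _     = sumFin-zero n
        ... | yes refl = trans (sumFin-cong n column) (sumFin-indicator n b (forward a b))
          where
          column : ∀ j → (if does (j ≟ b) ∧ ⌊ a <? j ⌋ then w a j else 0)
                         ≡ (if does (j ≟ b) then forward a b else 0)
          column j with j ≟ b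
          ... | yes refl = refl
          ... | no _     = refl

    module _ (w-sym : ∀ i j → w i j ≡ w j i) where

      weightOf-edge : ∀ {a b} → a ≢ b → weightOf (edge a b) ≡ w a b
      weightOf-edge {a} {b} a≢b =
        trans (weightOf-∨ _ _ arcs-disjoint) (trans (cong₂ _+_ (weightOf-arc a b) (weightOf-arc b a)) both-directions)
        where
        arcs-disjoint : ∀ i j → does (i ≟ a) ∧ does (j ≟ b) ≡ true → does (i ≟ b) ∧ does (j ≟ a) ≡ false
        arcs-disjoint i j e with i ≟ a | i ≟ b
        ... | yes refl | yes a≡b = ⊥-elim (a≢b a≡b)
        ... | yes refl | no _    = refl
        both-directions : forward a b + forward b a ≡ w a b
        both-directions with a <? b | b <? a
        ... | yes a<b | yes b<a = ⊥-elim (<-asym a<b b<a)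
        ... | yes _   | no _    = +-identityʳ (w a b)
        ... | no _    | yes _   = sym (w-sym a b)
        ... | no a≮b  | no b≮a with <-cmp a b
        ... | tri< a<b _ _ = ⊥-elim (a≮b a<b)
        ... | tri≈ _ a≡b _ = ⊥-elim (a≢b a≡b)
        ... | tri> _ _ b<a = ⊥-elim (b≮a b<a)

      weightOf-addEdge : ∀ {F u v} → IsStarForest F → u ≢ v → Isolated F v →
                         weightOf (addEdge F u v) ≡ weightOf F + w u v
      weightOf-addEdge {F} {u} {v} forest u≢v v-isolated =
        trans (weightOf-∨ F (edge u v) new-edge) (cong (weightOf F +_) (weightOf-edge u≢v))
        where
        new-edge : ∀ i j → F i j ≡ true → edge u v i j ≡ false
        new-edge i j ij with edge u v i j in e
        ... | false = refl
        ... | true with edge-endpoints {u} {v} {i} {j} e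
        ... | inj₁ (refl , refl) = ⊥-elim (not-¬ ij (isolated-apart forest v-isolated u))
        ... | inj₂ (refl , refl) = ⊥-elim (not-¬ ij (v-isolated u))

  recentre : ∀ {F} → IsStarForest F → ∀ u →
             Σ EdgeSet λ F₁ → IsStarForest F₁ × Centre F₁ u
                            × (∀ {z} → Covered F z → Covered F₁ z ⊎ z ≡ u)
                            × (∀ {z} → Isolated F z → Isolated F₁ z)
  recentre {F} forest u with covered? F u
  ... | no uncovered =
    F , forest , isolated⇒centre {F} (uncovered⇒isolated {F} uncovered) , inj₁ , λ isolated → isolated
  ... | yes (c , uc) with centre-or-pendant forest uc
  ... | inj₁ centre = F , forest , centre , inj₁ , λ isolated → isolated
  ... | inj₂ (u-pendant , t , ct , t≢u) =
    removeEdge F c u , removeEdge-starForest forest ,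
    isolated⇒centre (removeEdge-isolates forest u-pendant) , removeEdge-covered-except forest ct t≢u ,
    removeEdge-isolated forest

  module _ (X : Fin n → Set) (X? : ∀ z → Dec (X z))
           (outer-neighbour : ∀ z → ¬ X z → ∃[ s ] (Adj G z s × ¬ X s)) where

    record CoversOutside (F : EdgeSet) (vs : List (Fin n)) : Set where
      field
        forest     : IsStarForest F
        X-isolated : ∀ z → X z → Isolated F z
        covers     : ∀ z → z ∈ vs → ¬ X z → Covered F z

    cover-one-more : ∀ {F vs} → CoversOutside F vs → ∀ v → Σ EdgeSet λ F′ → CoversOutside F′ (v ∷ vs)
    cover-one-more {F} {vs} covering v with X? v | covered? F v
    ... | yes v∈X | _ = F , record
      { forest = CoversOutside.forest covering ; X-isolated = CoversOutside.X-isolated covering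
      ; covers = λ { z (here refl) z∉X → ⊥-elim (z∉X v∈X)
                   ; z (there z∈vs) → CoversOutside.covers covering z z∈vs } }
    ... | no _ | yes v-covered = F , record
      { forest = CoversOutside.forest covering ; X-isolated = CoversOutside.X-isolated covering
      ; covers = λ { z (here refl) _ → v-covered ; z (there z∈vs) → CoversOutside.covers covering z z∈vs } }
    ... | no v∉X | no v-uncovered with outer-neighbour v v∉X
    ... | u , vu , u∉X with recentre (CoversOutside.forest covering) u
    ... | F₁ , forest₁ , u-centre , keeps-covered , keeps-isolated =
      addEdge F₁ u v , record
        { forest     = addEdge-starForest forest₁ uv v-isolated u-centre
        ; X-isolated = λ z z∈X → addEdge-isolated forest₁ uv v-isolated
                                   (keeps-isolated (CoversOutside.X-isolated covering z z∈X))
                                   (λ { refl → u∉X z∈X }) (λ { refl → v∉X z∈X })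
        ; covers     = covers′
        }
      where
      uv : Adj G u v
      uv = Adj-sym vu
      v-isolated : Isolated F₁ v
      v-isolated = keeps-isolated (uncovered⇒isolated {F} v-uncovered)
      covers′ : ∀ z → z ∈ v ∷ vs → ¬ X z → Covered (addEdge F₁ u v) z
      covers′ z (here refl) _ = addEdge-covered-leaf {F₁} u v
      covers′ z (there z∈vs) z∉X with keeps-covered (CoversOutside.covers covering z z∈vs z∉X)
      ... | inj₁ z-covered = addEdge-covered forest₁ uv v-isolated z-covered
      ... | inj₂ refl      = addEdge-covered-centre {F₁} u v

    covering-from : ∀ vs → Σ EdgeSet λ F → CoversOutside F vs
    covering-from []       =
      (λ _ _ → false) , record { forest = ∅-starForest ; X-isolated = λ _ _ _ → refl ; covers = λ _ () }
    covering-from (v ∷ vs) = cover-one-more (proj₂ (covering-from vs)) v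

    starForest-covering-outside : Σ EdgeSet λ F → IsStarForest F × (∀ z → X z → Isolated F z)
                                                                × (∀ z → ¬ X z → Covered F z)
    starForest-covering-outside with covering-from (allFin n)
    ... | F , record { forest = forest ; X-isolated = X-isolated ; covers = covers } =
      F , forest , X-isolated , λ z → covers z (∈-allFin z)

  -- Grafting stars onto a star forest

  Balanced : (Fin n → Fin n → ℕ) → Set
  Balanced w = ∀ H₁ H₂ → IsStarFactor G H₁ → IsStarFactor G H₂ → weight G H₁ w ≡ weight G H₂ w

  -- The labels r i name a few vertices of G, some pairs of which are joined by the `local` edges.
  -- A pattern lists (centre , leaf) pairs of labels, grafted onto F one by one by `build`.
  -- `valid` checks that every leaf is still free, every centre is free or already a hub, every
  -- edge is local, and that no label is left free at the end; on concrete patterns it evaluates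
  -- to true, so `refl` proves it.
  module Grafting (w : Fin n → Fin n → ℕ) (w-sym : ∀ i j → w i j ≡ w j i)
                 (balanced : Balanced w)
                 {k : ℕ} (r : Fin k → Fin n) (r-injective : ∀ {i j} → r i ≡ r j → i ≡ j)
                 (local : List (Fin k × Fin k)) (local-adj : All (λ (a , b) → Adj G (r a) (r b)) local) where

    open DecMembership (≡-dec (_≟_ {k}) (_≟_ {k})) using (_∈?_)

    isLocal : Fin k → Fin k → Bool
    isLocal a b = does ((a , b) ∈? local) ∨ does ((b , a) ∈? local)

    isLocal-adj : ∀ {a b} → isLocal a b ≡ true → Adj G (r a) (r b)
    isLocal-adj {a} {b} e with (a , b) ∈? local | (b , a) ∈? local
    ... | yes ab∈ | _      = All.lookup local-adj ab∈
    ... | no _    | yes ba∈ = Adj-sym (All.lookup local-adj ba∈)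
    ... | no _    | no _    = ⊥-elim (not-¬ e refl)

    record Frame (F : EdgeSet) (free hub : Fin k → Bool) : Set where
      field
        forest         : IsStarForest F
        others-covered : ∀ z → Covered F z ⊎ ∃[ i ] r i ≡ z
        free-isolated  : ∀ i → free i ≡ true → Isolated F (r i)
        used-covered   : ∀ i → free i ≡ false → Covered F (r i)
        hub-centre     : ∀ i → hub i ≡ true → Centre F (r i)
        hubs-apart     : ∀ i j → hub i ≡ true → hub j ≡ true → F (r i) (r j) ≡ false
        hub-used       : ∀ i → hub i ≡ true → free i ≡ false

    Pattern : Set
    Pattern = List (Fin k × Fin k)

    markUsed : (Fin k → Bool) → Fin k → Fin k → Fin k → Bool
    markUsed free a b i = free i ∧ not (does (i ≟ a) ∨ does (i ≟ b))

    markHub : (Fin k → Bool) → Fin k → Fin k → Bool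
    markHub hub a i = hub i ∨ does (i ≟ a)

    valid : (free hub : Fin k → Bool) → Pattern → Bool
    valid free hub []            = does (all? λ i → free i Bool.≟ false)
    valid free hub ((a , b) ∷ p) =
      isLocal a b ∧ free b ∧ (hub a ∨ free a) ∧ valid (markUsed free a b) (markHub hub a) p

    build : EdgeSet → Pattern → EdgeSet
    build F []            = F
    build F ((a , b) ∷ p) = build (addEdge F (r a) (r b)) p

    patternWeight : Pattern → ℕ
    patternWeight p = sum (map (λ (a , b) → w (r a) (r b)) p)

    graft : ∀ {F free hub a b} → Frame F free hub → isLocal a b ≡ true → free b ≡ true → hub a ∨ free a ≡ true →
            Frame (addEdge F (r a) (r b)) (markUsed free a b) (markHub hub a)
    graft {F} {free} {hub} {a} {b} frame ab b-free a-ready = record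
      { forest         = addEdge-starForest forest ab-adj b-isolated a-centre
      ; others-covered = λ z → Sum.map₁ (addEdge-covered forest ab-adj b-isolated) (others-covered z)
      ; free-isolated  = free-isolated′
      ; used-covered   = used-covered′
      ; hub-centre     = hub-centre′
      ; hubs-apart     = hubs-apart′
      ; hub-used       = hub-used′
      }
      where
      open Frame frame
      ab-adj : Adj G (r a) (r b)
      ab-adj = isLocal-adj ab
      b-isolated : Isolated F (r b)
      b-isolated = free-isolated b b-free
      a≢b : a ≢ b
      a≢b a≡b = Adj-irrefl ab-adj (cong r a≡b)
      ra≢ : ∀ {i j} → i ≢ j → r i ≢ r j
      ra≢ i≢j e = i≢j (r-injective e)
      a-centre : Centre F (r a)
      a-centre = [ hub-centre a , (λ a-free → isolated⇒centre {F} (free-isolated a a-free)) ]′ (∨-true a-ready)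
      a-apart : ∀ j → hub j ≡ true ⊎ j ≡ a → F (r a) (r j) ≡ false
      a-apart j j-hub = [ (λ a-hub → [ hubs-apart a j a-hub , (λ { refl → hubs-apart a a a-hub a-hub }) ]′ j-hub)
                        , (λ a-free → free-isolated a a-free (r j)) ]′ (∨-true a-ready)
      hub≢b : ∀ {i} → hub i ≡ true → i ≢ b
      hub≢b i-hub refl = not-¬ b-free (hub-used b i-hub)

      free-isolated′ : ∀ i → markUsed free a b i ≡ true → Isolated (addEdge F (r a) (r b)) (r i)
      free-isolated′ i e with i ≟ a | i ≟ b | free i in i-free
      ... | no i≢a | no i≢b | true =
        addEdge-isolated forest ab-adj b-isolated (free-isolated i i-free) (ra≢ i≢a) (ra≢ i≢b)

      used-covered′ : ∀ i → markUsed free a b i ≡ false → Covered (addEdge F (r a) (r b)) (r i)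
      used-covered′ i e with i ≟ a | i ≟ b | free i in i-free
      ... | yes refl | _      | _     = addEdge-covered-centre {F} (r a) (r b)
      ... | no _     | yes refl | _   = addEdge-covered-leaf {F} (r a) (r b)
      ... | no _     | no _   | false = addEdge-covered forest ab-adj b-isolated (used-covered i i-free)

      hub-centre′ : ∀ i → markHub hub a i ≡ true → Centre (addEdge F (r a) (r b)) (r i)
      hub-centre′ i e with i ≟ a | hub i in i-hub
      ... | yes refl | _    = addEdge-centre forest ab-adj b-isolated a-centre
      ... | no i≢a   | true = addEdge-centre-other forest ab-adj b-isolated (hub-centre i i-hub) (ra≢ i≢a)
                                (ra≢ (hub≢b i-hub)) (trans (symmetric forest (r i) (r a)) (a-apart i (inj₁ i-hub)))

      hub-or-a : ∀ i → markHub hub a i ≡ true → hub i ≡ true ⊎ i ≡ a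
      hub-or-a i e with i ≟ a | hub i
      ... | yes i≡a | _    = inj₂ i≡a
      ... | no _    | true = inj₁ refl

      hub-or-a≢b : ∀ {i} → hub i ≡ true ⊎ i ≡ a → i ≢ b
      hub-or-a≢b = [ hub≢b , (λ { refl → a≢b }) ]′

      hubs-apart′ : ∀ i j → markHub hub a i ≡ true → markHub hub a j ≡ true →
                    addEdge F (r a) (r b) (r i) (r j) ≡ false
      hubs-apart′ i j i-hub j-hub = cong₂ _∨_ old-apart new-apart
        where
        old-apart : F (r i) (r j) ≡ false
        old-apart with hub-or-a i i-hub
        ... | inj₂ refl  = a-apart j (hub-or-a j j-hub)
        ... | inj₁ i-hub′ with hub-or-a j j-hub
        ... | inj₁ j-hub′ = hubs-apart i j i-hub′ j-hub′
        ... | inj₂ refl   = trans (symmetric forest (r i) (r a)) (a-apart i (inj₁ i-hub′))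
        new-apart : edge (r a) (r b) (r i) (r j) ≡ false
        new-apart = edge-without-endpoint (ra≢ (hub-or-a≢b (hub-or-a i i-hub))) (ra≢ (hub-or-a≢b (hub-or-a j j-hub)))

      hub-used′ : ∀ i → markHub hub a i ≡ true → markUsed free a b i ≡ false
      hub-used′ i e with i ≟ a | hub i in i-hub
      ... | yes _ | _    = ∧-zeroʳ (free i)
      ... | no _  | true rewrite hub-used i i-hub = refl

    realise : ∀ {F free hub} p → Frame F free hub → valid free hub p ≡ true →
              Σ (IsStarForest (build F p)) λ forest →
                IsStarFactor G (toSpanning forest) × weightOf w (build F p) ≡ weightOf w F + patternWeight p
    realise {F} {free} [] frame ok = forest , starForest⇒starFactor forest covered , sym (+-identityʳ (weightOf w F))
      where
      open Frame frame
      covered : ∀ z → Covered F z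
      covered z = [ (λ z-covered → z-covered) , (λ { (i , refl) → used-covered i (does⇒witness (all? _) ok i) }) ]′
                  (others-covered z)
    realise {F} {free} {hub} ((a , b) ∷ p) frame ok
      with ∧-true (isLocal a b) ok
    ... | ab , ok₁ with ∧-true (free b) ok₁
    ... | b-free , ok₂ with ∧-true (hub a ∨ free a) ok₂
    ... | a-ready , rest with realise p (graft frame ab b-free a-ready) rest
    ... | forest , star-factor , weight-p = forest , star-factor , (begin
      weightOf w (build F′ p)                         ≡⟨ weight-p ⟩
      weightOf w F′ + patternWeight p                 ≡⟨ cong (_+ patternWeight p) (weightOf-addEdge w w-sym
                                                             (Frame.forest frame) ra≢rb (Frame.free-isolated frame b b-free)) ⟩
      weightOf w F + w (r a) (r b) + patternWeight p  ≡⟨ +-assoc (weightOf w F) _ _ ⟩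
      weightOf w F + patternWeight ((a , b) ∷ p)      ∎)
      where
      open ≡-Reasoning
      F′ : EdgeSet
      F′ = addEdge F (r a) (r b)
      ra≢rb : r a ≢ r b
      ra≢rb = Adj-irrefl (isLocal-adj ab)

    patterns-balanced : ∀ {F free hub} p q → Frame F free hub → valid free hub p ≡ true → valid free hub q ≡ true →
                        patternWeight p ≡ patternWeight q
    patterns-balanced {F} p q frame p-ok q-ok with realise p frame p-ok | realise q frame q-ok
    ... | forest-p , star-p , weight-p | forest-q , star-q , weight-q =
      +-cancelˡ-≡ (weightOf w F) _ _
        (trans (sym weight-p) (trans (balanced (toSpanning forest-p) (toSpanning forest-q) star-p star-q) weight-q))

  -- Pentagons

  cycSucc⇒next : ∀ i j → CycSucc G 5 i j → j ≡ next i
  cycSucc⇒next = toWitness {a? = all? λ i → all? λ j → cycSucc? i j →-dec (j ≟ next i)} _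
    where
    cycSucc? : ∀ i j → Dec (CycSucc G 5 i j)
    cycSucc? i j = (suc (toℕ i) ℕ.≟ toℕ j) ⊎-dec ((suc (toℕ i) ℕ.≟ 5) ×-dec (toℕ j ℕ.≟ 0))

  next-cycSucc : ∀ i → CycSucc G 5 i (next i)
  next-cycSucc 0F = inj₁ refl
  next-cycSucc 1F = inj₁ refl
  next-cycSucc 2F = inj₁ refl
  next-cycSucc 3F = inj₁ refl
  next-cycSucc 4F = inj₂ (refl , refl)

  record Pentagon : Set where
    field
      corner           : Fin 5 → Fin n
      corner-injective : ∀ {i j} → corner i ≡ corner j → i ≡ j
      side             : ∀ i → Adj G (corner i) (corner (next i))

  open Pentagon

  cycle⇒pentagon : Cycle G 5 → Pentagon
  cycle⇒pentagon C = record
    { corner = Cycle.vtx C ; corner-injective = Cycle.inj C ; side = λ i → Cycle.closed C i (next i) (next-cycSucc i) }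

  rotate : ℕ → Pentagon → Pentagon
  rotate m P = record
    { corner           = λ i → corner P (next^ m i)
    ; corner-injective = λ e → next^-injective m (corner-injective P e)
    ; side             = λ i → subst (λ j → Adj G (corner P (next^ m i)) (corner P j))
                                     (sym (next^-next m i)) (side P (next^ m i))
    }

  IsCorner : Pentagon → Fin n → Set
  IsCorner P z = ∃[ i ] corner P i ≡ z

  isCorner? : ∀ P z → Dec (IsCorner P z)
  isCorner? P z = any? λ i → corner P i ≟ z

  OuterNeighbour : Pentagon → Fin n → Set
  OuterNeighbour P z = ∃[ s ] (Adj G z s × ¬ IsCorner P s)

  outerNeighbour? : ∀ P z → Dec (OuterNeighbour P z)
  outerNeighbour? P z = any? λ s → (adj z s Bool.≟ true) ×-dec ¬? (isCorner? P s)

  module _ (w : Fin n → Fin n → ℕ) (w-sym : ∀ i j → w i j ≡ w j i) (w-pos : ∀ i j → Adj G i j → 0 < w i j)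
           (balanced : Balanced w)
           (P : Pentagon) {F : EdgeSet} (forest : IsStarForest F) (corner-isolated : ∀ i → Isolated F (corner P i)) where

    -- Labels 0, 1, …, 5 stand for z, c₀, …, c₄; α = γ and δ = β force w(c₃c₂) = 0.
    pendant-configuration-impossible : ∀ {z} → ¬ IsCorner P z → Adj G (corner P 0F) z → Isolated F z →
                                       (∀ q → ¬ IsCorner P q → q ≢ z → Covered F q) → ⊥
    pendant-configuration-impossible {z} z∉P c₀z z-isolated outside-covered =
      ℕ.<⇒≢ (w-pos _ _ (Adj-sym (side P 2F)))
        (sym (pendant-arithmetic (ω 1F 0F) (ω 3F 2F) (ω 1F 2F) (ω 4F 3F) (ω 1F 5F) (ω 3F 4F) (ω 4F 5F)
                              (patterns-balanced α γ frame refl refl) (patterns-balanced δ β frame refl refl)))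
      where
      r : Fin 6 → Fin n
      r = z Vector.∷ corner P
      ω : Fin 6 → Fin 6 → ℕ
      ω i j = w (r i) (r j)
      open Grafting w w-sym balanced r (cons-injective (corner-injective P) (λ i e → z∉P (i , e)))
             ((1F , 0F) ∷ (1F , 2F) ∷ (2F , 3F) ∷ (3F , 4F) ∷ (4F , 5F) ∷ (5F , 1F) ∷ [])
             (c₀z ∷ side P 0F ∷ side P 1F ∷ side P 2F ∷ side P 3F ∷ side P 4F ∷ [])

      covered-or-label : ∀ q → Covered F q ⊎ ∃[ i ] r i ≡ q
      covered-or-label q with isCorner? P q | q ≟ z
      ... | yes (i , e) | _        = inj₂ (Fin.suc i , e)
      ... | no _        | yes q≡z  = inj₂ (0F , sym q≡z)
      ... | no q∉P      | no q≢z   = inj₁ (outside-covered q q∉P q≢z)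

      frame : Frame F (λ _ → true) (λ _ → false)
      frame = record
        { forest         = forest
        ; others-covered = covered-or-label
        ; free-isolated  = λ { 0F _ → z-isolated ; (Fin.suc i) _ → corner-isolated i }
        ; used-covered   = λ _ ()
        ; hub-centre     = λ _ ()
        ; hubs-apart     = λ _ _ ()
        ; hub-used       = λ _ ()
        }

      α γ δ β : Pattern
      α = (1F , 0F) ∷ (3F , 2F) ∷ (4F , 5F) ∷ []
      γ = (1F , 0F) ∷ (1F , 2F) ∷ (4F , 3F) ∷ (4F , 5F) ∷ []
      δ = (1F , 0F) ∷ (1F , 5F) ∷ (3F , 2F) ∷ (3F , 4F) ∷ []
      β = (1F , 0F) ∷ (1F , 5F) ∷ (1F , 2F) ∷ (3F , 4F) ∷ []

    -- Labels 0, 1, 2, …, 6 stand for x, y, c₀, …, c₄; X = XY and Y = R force w(c₃c₄) = 0.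
    centre-configuration-impossible : ∀ {x y} → ¬ IsCorner P x → ¬ IsCorner P y → x ≢ y → ¬ Adj G x y →
                                      (∀ q → ¬ IsCorner P q → Covered F q) → Centre F x → Centre F y →
                                      Adj G x (corner P 0F) → Adj G y (corner P 1F) → ⊥
    centre-configuration-impossible {x} {y} x∉P y∉P x≢y x≁y outside-covered x-centre y-centre xc₀ yc₁ =
      ℕ.<⇒≢ (w-pos _ _ (side P 3F))
        (sym (centre-arithmetic (ω 0F 2F) (ω 3F 4F) (ω 6F 5F) (ω 5F 6F) (ω 5F 4F) (ω 6F 2F) (ω 1F 3F)
                                (patterns-balanced X XY frame refl refl) (patterns-balanced Y R frame refl refl)))
      where
      r : Fin 7 → Fin n
      r = x Vector.∷ y Vector.∷ corner P
      ω : Fin 7 → Fin 7 → ℕ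
      ω i j = w (r i) (r j)
      r-injective : ∀ {i j} → r i ≡ r j → i ≡ j
      r-injective = cons-injective (cons-injective (corner-injective P) (λ i e → y∉P (i , e)))
                                   (λ { 0F y≡x → x≢y (sym y≡x) ; (Fin.suc i) e → x∉P (i , e) })
      open Grafting w w-sym balanced r r-injective
             ((0F , 2F) ∷ (1F , 3F) ∷ (3F , 4F) ∷ (4F , 5F) ∷ (5F , 6F) ∷ (6F , 2F) ∷ [])
             (xc₀ ∷ yc₁ ∷ side P 1F ∷ side P 2F ∷ side P 3F ∷ side P 4F ∷ [])

      frame : Frame F (false Vector.∷ false Vector.∷ λ _ → true) (true Vector.∷ true Vector.∷ λ _ → false)
      frame = record
        { forest         = forest
        ; others-covered = λ q → [ (λ (i , e) → inj₂ (Fin.suc (Fin.suc i) , e))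
                                 , (λ q∉P → inj₁ (outside-covered q q∉P)) ]′ (toSum (isCorner? P q))
        ; free-isolated  = λ { 0F () ; 1F () ; (Fin.suc (Fin.suc i)) _ → corner-isolated i }
        ; used-covered   = λ { 0F _ → outside-covered x x∉P ; 1F _ → outside-covered y y∉P
                             ; (Fin.suc (Fin.suc i)) () }
        ; hub-centre     = λ { 0F _ → x-centre ; 1F _ → y-centre ; (Fin.suc (Fin.suc i)) () }
        ; hubs-apart     = λ { 0F 0F _ _ → absent-if-nonadjacent forest (λ xx → Adj-irrefl xx refl)
                             ; 0F 1F _ _ → absent-if-nonadjacent forest x≁y
                             ; 1F 0F _ _ → absent-if-nonadjacent forest (λ yx → x≁y (Adj-sym yx))
                             ; 1F 1F _ _ → absent-if-nonadjacent forest (λ yy → Adj-irrefl yy refl) }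
        ; hub-used       = λ { 0F _ → refl ; 1F _ → refl }
        }

      X XY Y R : Pattern
      X  = (0F , 2F) ∷ (3F , 4F) ∷ (6F , 5F) ∷ []
      XY = (0F , 2F) ∷ (1F , 3F) ∷ (5F , 4F) ∷ (5F , 6F) ∷ []
      Y  = (1F , 3F) ∷ (5F , 4F) ∷ (6F , 2F) ∷ []
      R  = (3F , 4F) ∷ (6F , 5F) ∷ (6F , 2F) ∷ []

  module _ (short-cycle-free : ∀ k → k < 5 → ¬ Cycle G k) where

    no-triangle : ∀ {a b c} → Adj G a b → Adj G b c → Adj G c a → ⊥
    no-triangle {a} {b} {c} ab bc ca = short-cycle-free 3 (s≤s (s≤s (s≤s (s≤s z≤n))))
      (cycleFromVec (a ∷ b ∷ c ∷ []) (s≤s (s≤s (s≤s z≤n)))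
        ((Adj-irrefl ab ∷ (λ a≡c → Adj-irrefl ca (sym a≡c)) ∷ []) ∷ (Adj-irrefl bc ∷ []) ∷ [] ∷ [])
        (ab ∷ bc ∷ [-]) ca)

    no-square : ∀ {a b c d} → a ≢ c → b ≢ d → Adj G a b → Adj G b c → Adj G c d → Adj G d a → ⊥
    no-square {a} {b} {c} {d} a≢c b≢d ab bc cd da = short-cycle-free 4 (s≤s (s≤s (s≤s (s≤s (s≤s z≤n)))))
      (cycleFromVec (a ∷ b ∷ c ∷ d ∷ []) (s≤s (s≤s (s≤s z≤n)))
        ((Adj-irrefl ab ∷ a≢c ∷ (λ a≡d → Adj-irrefl da (sym a≡d)) ∷ []) ∷ (Adj-irrefl bc ∷ b≢d ∷ []) ∷
         (Adj-irrefl cd ∷ []) ∷ [] ∷ [])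
        (ab ∷ bc ∷ cd ∷ [-]) da)

    module _ (P : Pentagon) where
      private
        c : Fin 5 → Fin n
        c = corner P

      chord-free : ∀ {i j} → Adj G (c i) (c j) → j ≡ next i ⊎ i ≡ next j
      chord-free {i} {j} cij with i ≟ j
      ... | yes refl = ⊥-elim (Adj-irrefl cij refl)
      ... | no i≢j with within-two-steps i j i≢j
      ... | inj₁ adjacent = adjacent
      ... | inj₂ (inj₁ refl) = ⊥-elim (no-triangle (side P i) (side P (next i)) (Adj-sym cij))
      ... | inj₂ (inj₂ refl) = ⊥-elim (no-triangle (side P j) (side P (next j)) cij)

      one-corner-neighbour : ∀ {z i j} → ¬ IsCorner P z → Adj G z (c i) → Adj G z (c j) → i ≡ j
      one-corner-neighbour {z} {i} {j} z∉P zi zj with i ≟ j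
      ... | yes i≡j = i≡j
      ... | no i≢j with within-two-steps i j i≢j
      ... | inj₁ (inj₁ refl) = ⊥-elim (no-triangle zi (side P i) (Adj-sym zj))
      ... | inj₁ (inj₂ refl) = ⊥-elim (no-triangle zj (side P j) (Adj-sym zi))
      ... | inj₂ (inj₁ refl) = ⊥-elim (no-square (λ z≡ → z∉P (next i , sym z≡)) (λ e → i≢j (corner-injective P e))
                                           zi (side P i) (side P (next i)) (Adj-sym zj))
      ... | inj₂ (inj₂ refl) = ⊥-elim (no-square (λ z≡ → z∉P (next j , sym z≡))
                                                 (λ e → i≢j (sym (corner-injective P e)))
                                           zj (side P j) (side P (next j)) (Adj-sym zi))

      big-corner-has-outer-neighbour : ∀ i → 3 ≤ degree G (c i) → OuterNeighbour P (c i)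
      big-corner-has-outer-neighbour i deg≥3 with outerNeighbour? P (c i)
      ... | yes found = found
      ... | no none   = ⊥-elim (ℕ.<-irrefl refl (ℕ.≤-trans deg≥3 (degree≤2 only-sides)))
        where
        only-sides : ∀ s → Adj G (c i) s → s ≡ c (next i) ⊎ s ≡ c (proj₁ (next-surjective i))
        only-sides s cs with isCorner? P s
        ... | no s∉P = ⊥-elim (none (s , cs , s∉P))
        ... | yes (j , refl) with chord-free cs
        ... | inj₁ refl = inj₁ refl
        ... | inj₂ i≡next-j =
          inj₂ (cong c (next-injective (trans (sym i≡next-j) (sym (proj₂ (next-surjective i))))))

      module _ (w : Fin n → Fin n → ℕ) (w-sym : ∀ i j → w i j ≡ w j i) (w-pos : ∀ i j → Adj G i j → 0 < w i j)
               (balanced : Balanced w)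
               {S : EdgeSet} (forest : IsStarForest S) (corners-isolated : ∀ q → IsCorner P q → Isolated S q)
               (outside-covered : ∀ q → ¬ IsCorner P q → Covered S q) where

        pendant-impossible : ∀ Q {z cz t} → (∀ q → IsCorner Q q → IsCorner P q) →
                             (∀ q → IsCorner P q → IsCorner Q q) → ¬ IsCorner P z → Adj G (corner Q 0F) z → Pendant S z cz → S cz t ≡ true → t ≢ z → ⊥
        pendant-impossible Q {z} {cz} Q⊆P P⊆Q z∉P c₀z z-pendant cz-t t≢z =
          pendant-configuration-impossible w w-sym w-pos balanced Q (removeEdge-starForest forest {cz} {z})
            (λ i → removeEdge-isolated forest (corners-isolated _ (Q⊆P _ (i , refl))))
            (λ z∈Q → z∉P (Q⊆P z z∈Q)) c₀z (removeEdge-isolates forest z-pendant) still-covered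
          where
          still-covered : ∀ q → ¬ IsCorner Q q → q ≢ z → Covered (removeEdge S cz z) q
          still-covered q q∉Q q≢z = [ (λ covered → covered) , (λ q≡z → ⊥-elim (q≢z q≡z)) ]′
            (removeEdge-covered-except forest cz-t t≢z (outside-covered q (λ q∈P → q∉Q (P⊆Q q q∈P))))

        rotated-corner : ∀ q → IsCorner P q → IsCorner (rotate 1 P) q
        rotated-corner q (j , e) with next-surjective j
        ... | i , refl = i , e

        outer-neighbours-impossible : ∀ {x y} → Adj G (c 0F) x → ¬ IsCorner P x →
                                      Adj G (c 1F) y → ¬ IsCorner P y → ⊥
        outer-neighbours-impossible {x} {y} c₀x x∉P c₁y y∉P
          with centre-or-pendant forest (proj₂ (outside-covered x x∉P))
             | centre-or-pendant forest (proj₂ (outside-covered y y∉P))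
        ... | inj₂ (x-pendant , _ , cx-t , t≢x) | _ =
          pendant-impossible P (λ _ q∈P → q∈P) (λ _ q∈P → q∈P) x∉P c₀x x-pendant cx-t t≢x
        ... | _ | inj₂ (y-pendant , _ , cy-t , t≢y) =
          pendant-impossible (rotate 1 P) (λ { _ (i , e) → next i , e }) rotated-corner y∉P c₁y y-pendant cy-t t≢y
        ... | inj₁ x-centre | inj₁ y-centre =
          centre-configuration-impossible w w-sym w-pos balanced P forest (λ i → corners-isolated (c i) (i , refl))
            x∉P y∉P x≢y x≁y outside-covered x-centre y-centre (Adj-sym c₀x) (Adj-sym c₁y)
          where
          x≢y : x ≢ y
          x≢y refl = no-triangle (Adj-sym c₀x) (side P 0F) c₁y
          x≁y : ¬ Adj G x y
          x≁y xy = no-square (λ e → x∉P (1F , sym e)) (λ e → y∉P (0F , e))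
                             (Adj-sym c₀x) (side P 0F) c₁y (Adj-sym xy)

      module _ (no-isolated : NoIsolatedVertices G) (no-stem : ∀ i → ¬ IsStem G (c i)) where

        outer-vertex-has-outer-neighbour : ∀ z → ¬ IsCorner P z → OuterNeighbour P z
        outer-vertex-has-outer-neighbour z z∉P with outerNeighbour? P z
        ... | yes found = found
        ... | no none with no-isolated z
        ... | t , zt with isCorner? P t
        ... | no t∉P = ⊥-elim (none (t , zt , t∉P))
        ... | yes (i , refl) = ⊥-elim (no-stem i (z , Adj-sym zt , degree-pendant zt only-ci))
          where
          only-ci : ∀ s → Adj G z s → s ≡ c i
          only-ci s zs with isCorner? P s
          ... | no s∉P = ⊥-elim (none (s , zs , s∉P))
          ... | yes (j , refl) = cong c (sym (one-corner-neighbour z∉P zt zs))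

        pentagon-not-in-Ω : 3 ≤ degree G (c 0F) → 3 ≤ degree G (c 1F) → ¬ InΩ G
        pentagon-not-in-Ω big₀ big₁ (w , (w-sym , w-pos) , balanced)
          with big-corner-has-outer-neighbour 0F big₀ | big-corner-has-outer-neighbour 1F big₁
             | starForest-covering-outside (IsCorner P) (isCorner? P) outer-vertex-has-outer-neighbour
        ... | x , c₀x , x∉P | y , c₁y , y∉P | S , forest , corners-isolated , outside-covered =
          outer-neighbours-impossible w w-sym w-pos balanced forest corners-isolated outside-covered c₀x x∉P c₁y y∉P

lemma2p4 : (G : Graph) → NoIsolatedVertices G → GirthEq G 5 →
    (C : Cycle G 5) →
    (∀ i → ¬ IsStem G (Cycle.vtx C i)) →
    (∃[ i ] ∃[ j ] (CycSucc G 5 i j × 3 ≤ degree G (Cycle.vtx C i) × 3 ≤ degree G (Cycle.vtx C j))) →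
    ¬ InΩ G
lemma2p4 G no-isolated (_ , short-cycle-free) C no-stem (i , j , i→j , big-i , big-j)
  with cycSucc⇒next G i j i→j
... | refl = pentagon-not-in-Ω G short-cycle-free P no-isolated (λ k → no-stem (next^ (toℕ i) k)) big₀ big₁
  where
  P : Pentagon G
  P = rotate G (toℕ i) (cycle⇒pentagon G C)
  big₀ : 3 ≤ degree G (Pentagon.corner P 0F)
  big₀ = subst (λ k → 3 ≤ degree G (Cycle.vtx C k)) (sym (next^-from-0 i)) big-i
  big₁ : 3 ≤ degree G (Pentagon.corner P 1F)
  big₁ = subst (λ k → 3 ≤ degree G (Cycle.vtx C k))
               (sym (trans (next^-next (toℕ i) 0F) (cong next (next^-from-0 i)))) big-j
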